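{- Let $\mathcal{C}$ be a seminormal crystal of type $A_{n-1}$ whose weights $\mathrm{wt}(x)\in\mathbb{Z}^n$ all have non-negative entries. Then for every $x\in\mathcal{C}$ and $i\in I$: (1) $\widetilde\varepsilon_i(x)\le\mathrm{wt}_{i+1}(x)$; (2) $\widetilde\varphi_i(x)\le\mathrm{wt}_i(x)$.
   Context: Fix $n\ge2$, $I=\{1,\dots,n-1\}$, $\alpha_i=\mathbf{e}_i-\mathbf{e}_{i+1}\in\mathbb{Z}^n$, standard inner product; $\mathrm{wt}_k(x)$ is the $k$-th entry of $\mathrm{wt}(x)$. A crystal of type $A_{n-1}$ is a non-empty set $\mathcal{C}$ with maps $\widetilde e_i,\widetilde f_i:\mathcal{C}\to\mathcal{C}\sqcup\{\bot\}$, $\widetilde\varepsilon_i,\widetilde\varphi_i:\mathcal{C}\to\mathbb{Z}\sqcup\{ -\infty\}$, $\mathrm{wt}:\mathcal{C}\to\mathbb{Z}^n$ such that (C1) $\widetilde e_i(x)=y\iff x=\widetilde f_i(y)$, and then $\mathrm{wt}(y)=\mathrm{wt}(x)+\alpha_i$, $\widetilde\varepsilon_i(y)=\widetilde\varepsilon_i(x)-1$, $\widetilde\varphi_i(y)=\widetilde\varphi_i(x)+1$; (C2) $\widetilde\varphi_i(x)=\widetilde\varepsilon_i(x)+\langle\mathrm{wt}(x),\alpha_i\rangle$; (C3) if $\widetilde\varepsilon_i(x)=-\infty$ then $\widetilde e_i(x)=\widetilde f_i(x)=\bot$. Seminormal: $\widetilde\varepsilon_i(x)=\max\{k:\widetilde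 e_i^k(x)\ne\bot\}$ and $\widetilde\varphi_i(x)=\max\{k:\widetilde f_i^k(x)\ne\bot\}$. (In the paper, non-negativity of weights is its standing convention: weights are representatives in $\mathbb{Z}^n$ modulo $(1,\dots,1)$ chosen so that highest weights are partitions.) -}

module Defs where

open import Data.Nat as ℕ using (ℕ; zero; suc)
open import Data.Fin as Fin using (Fin; inject₁) renaming (suc to fsuc)
open import Data.Integer as ℤ using (ℤ; +_)
open import Data.Maybe using (Maybe; just; nothing)
open import Data.Product using (Σ; _×_; _,_)
open import Relation.Binary.PropositionalEquality using (_≡_)
open import Relation.Nullary using (¬_)

data ℤ∞ : Set where
  -∞  : ℤ∞
  fin : ℤ → ℤ∞

Weight : ℕ → Set
Weight n = Fin n → ℤ

-- ⟨ w , α_i ⟩ = w_i - w_{i+1}, for i ∈ I = {1..n-1} represented by Fin m (n = suc m),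
-- entry i is  inject₁ i  and entry i+1 is  fsuc i
pairα : ∀ {m} → Weight (suc m) → Fin m → ℤ
pairα w i = w (inject₁ i) ℤ.- w (fsuc i)

αv : ∀ {k} → Fin k → Fin (suc k) → ℤ
αv Fin.zero Fin.zero = + 1
αv Fin.zero (Fin.suc Fin.zero) = ℤ.-[1+ 0 ]
αv Fin.zero (Fin.suc (Fin.suc _)) = + 0
αv (Fin.suc i) Fin.zero = + 0
αv (Fin.suc i) (Fin.suc j) = αv i j

addα : ∀ {m} → Weight (suc m) → Fin m → Weight (suc m)
addα w i j = w j ℤ.+ αv i j

_+∞_ : ℤ∞ → ℤ → ℤ∞
-∞ +∞ z = -∞
fin a +∞ z = fin (a ℤ.+ z)

-- crystal of type A_{n-1}, n = suc m; ⊥ is  nothing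
record Crystal (m : ℕ) : Set₁ where
  field
    C    : Set
    inhabited : C
    e f  : Fin m → C → Maybe C
    ε φ  : Fin m → C → ℤ∞
    wt   : C → Weight (suc m)
    e⇒f  : ∀ i x y → e i x ≡ just y → f i y ≡ just x
    f⇒e  : ∀ i x y → f i y ≡ just x → e i x ≡ just y
    e-wt : ∀ i x y → e i x ≡ just y → wt y ≡ addα (wt x) i
    e-ε  : ∀ i x y → e i x ≡ just y → ε i y +∞ (+ 1) ≡ ε i x
    e-φ  : ∀ i x y → e i x ≡ just y → φ i y ≡ φ i x +∞ (+ 1)
    φ-ε  : ∀ i x → φ i x ≡ ε i x +∞ pairα (wt x) i
    -∞-e : ∀ i x → ε i x ≡ -∞ → e i x ≡ nothing
    -∞-f : ∀ i x → ε i x ≡ -∞ → f i x ≡ nothing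

iter : ∀ {A : Set} → (A → Maybe A) → ℕ → A → Maybe A
iter g zero x = just x
iter g (suc k) x with iter g k x
... | nothing = nothing
... | just y = g y

IsMax : (ℕ → Set) → ℕ → Set
IsMax P k = P k × (∀ j → P j → j ℕ.≤ k)

Defined : ∀ {A : Set} → Maybe A → Set
Defined u = ¬ (u ≡ nothing)

record Seminormal {m : ℕ} (𝒞 : Crystal m) : Set where
  open Crystal 𝒞
  field
    ε-max : ∀ i x → Σ ℕ λ k → IsMax (λ j → Defined (iter (e i) j x)) k × (ε i x ≡ fin (+ k))
    φ-max : ∀ i x → Σ ℕ λ k → IsMax (λ j → Defined (iter (f i) j x)) k × (φ i x ≡ fin (+ k))

{-# OPTIONS --safe #-}
module Submission where

-- Proof idea: along the i-string through x, every e_i lowers wt_{i+1} by one and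
-- every f_i lowers wt_i by one.  By seminormality e_i can be applied ε_i(x) times
-- (f_i can be applied φ_i(x) times), so wt_{i+1}(x) − ε_i(x) (resp. wt_i(x) − φ_i(x))
-- is the weight entry of an element of the crystal, hence non-negative.

open import Defs
open import Data.Nat using (ℕ; suc; _≤_)
open import Data.Fin using (Fin; inject₁) renaming (suc to fsuc)
open import Data.Integer as ℤ using (ℤ; +_; -[1+_])
import Data.Integer.Properties as ℤ
open import Data.Product using (Σ; _×_; _,_)
open import Data.Maybe using (Maybe; just; nothing)
open import Data.Maybe.Properties using (just-injective)
open import Relation.Binary.PropositionalEquality
open import Relation.Nullary using (contradiction)

αv-inject₁ : ∀ {k} (i : Fin k) → αv i (inject₁ i) ≡ + 1
αv-inject₁ Fin.zero = refl
αv-inject₁ (fsuc i) = αv-inject₁ i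

αv-fsuc : ∀ {k} (i : Fin k) → αv i (fsuc i) ≡ -[1+ 0 ]
αv-fsuc Fin.zero = refl
αv-fsuc (fsuc i) = αv-fsuc i

fin-injective : ∀ {a b} → fin a ≡ fin b → a ≡ b
fin-injective refl = refl

module _ {A : Set} (g : A → Maybe A) (h : A → ℤ) where

  Descends : Set
  Descends = ∀ x y → g x ≡ just y → h y ℤ.+ + 1 ≡ h x

  iter-descends : Descends → ∀ k x y → iter g k x ≡ just y → h y ℤ.+ + k ≡ h x
  iter-descends _ ℕ.zero x y eq
    rewrite just-injective eq = ℤ.+-identityʳ (h y)
  iter-descends desc (suc k) x y eq with iter g k x in eqₖ
  ... | just z = begin
    h y ℤ.+ (+ 1 ℤ.+ + k)   ≡⟨ ℤ.+-assoc (h y) (+ 1) (+ k) ⟨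
    (h y ℤ.+ + 1) ℤ.+ + k   ≡⟨ cong (ℤ._+ + k) (desc z y eq) ⟩
    h z ℤ.+ + k             ≡⟨ iter-descends desc k x z eqₖ ⟩
    h x                     ∎
    where open ≡-Reasoning

  defined-iter-length≤ : (∀ z → + 0 ℤ.≤ h z) → Descends →
                         ∀ k x → Defined (iter g k x) → + k ℤ.≤ h x
  defined-iter-length≤ h≥0 desc k x defined with iter g k x in eq
  ... | nothing = contradiction refl defined
  ... | just y  = subst (+ k ℤ.≤_) (iter-descends desc k x y eq)
                        (ℤ.+-mono-≤ (h≥0 y) (ℤ.≤-refl {+ k}))

  string-length≤ : (∀ z → + 0 ℤ.≤ h z) → Descends → ∀ {u} x →
                   Σ ℕ (λ k → IsMax (λ j → Defined (iter g j x)) k × (u ≡ fin (+ k))) →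
                   ∀ k → u ≡ fin k → k ℤ.≤ h x
  string-length≤ h≥0 desc x (k , (defined , _) , u≡k) k′ u≡k′
    rewrite fin-injective (trans (sym u≡k′) u≡k) = defined-iter-length≤ h≥0 desc k x defined

module _ {m : ℕ} (𝒞 : Crystal m) (i : Fin m) where
  open Crystal 𝒞

  e-descends : Descends (e i) (λ z → wt z (fsuc i))
  e-descends x y eq = begin
    wt y (fsuc i) ℤ.+ + 1                      ≡⟨ cong (λ w → w (fsuc i) ℤ.+ + 1) (e-wt i x y eq) ⟩
    (wt x (fsuc i) ℤ.+ αv i (fsuc i)) ℤ.+ + 1  ≡⟨ cong (λ a → (wt x (fsuc i) ℤ.+ a) ℤ.+ + 1) (αv-fsuc i) ⟩
    (wt x (fsuc i) ℤ.+ -[1+ 0 ]) ℤ.+ + 1       ≡⟨ ℤ.+-assoc (wt x (fsuc i)) -[1+ 0 ] (+ 1) ⟩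
    wt x (fsuc i) ℤ.+ + 0                      ≡⟨ ℤ.+-identityʳ (wt x (fsuc i)) ⟩
    wt x (fsuc i)                              ∎
    where open ≡-Reasoning

  f-descends : Descends (f i) (λ z → wt z (inject₁ i))
  f-descends x y eq = sym (begin
    wt x (inject₁ i)                        ≡⟨ cong (λ w → w (inject₁ i)) (e-wt i y x (f⇒e i y x eq)) ⟩
    wt y (inject₁ i) ℤ.+ αv i (inject₁ i)   ≡⟨ cong (λ a → wt y (inject₁ i) ℤ.+ a) (αv-inject₁ i) ⟩
    wt y (inject₁ i) ℤ.+ + 1                ∎)
    where open ≡-Reasoning

lemma4p3 : (m : ℕ) → 1 ≤ m → (𝒞 : Crystal m) → Seminormal 𝒞
    → (∀ x j → + 0 ℤ.≤ Crystal.wt 𝒞 x j)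
    → ∀ (x : Crystal.C 𝒞) (i : Fin m)
    → (∀ k → Crystal.ε 𝒞 i x ≡ fin k → k ℤ.≤ Crystal.wt 𝒞 x (fsuc i))
    × (∀ k → Crystal.φ 𝒞 i x ≡ fin k → k ℤ.≤ Crystal.wt 𝒞 x (inject₁ i))
lemma4p3 m _ 𝒞 seminormal wt≥0 x i =
    string-length≤ (e i) (λ z → wt z (fsuc i)) (λ z → wt≥0 z (fsuc i)) (e-descends 𝒞 i) x (ε-max i x)
  , string-length≤ (f i) (λ z → wt z (inject₁ i)) (λ z → wt≥0 z (inject₁ i)) (f-descends 𝒞 i) x (φ-max i x)
  where
  open Crystal 𝒞
  open Seminormal seminormal
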